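{- Let $\Sigma$ be a finite alphabet. For every piecewise testable language $L$ of nonempty strings over $\Sigma$ there exists a $\mathsf{C}\text{ - }\mathsf{RASP}$ language model that recognizes $L$.
   Context: A language $L$ (of nonempty strings over $\Sigma$) is piecewise testable if it is a finite Boolean combination of languages of the form $\{w : s \text{ is a (not necessarily contiguous) subsequence of } w\}$ for strings $s\in\Sigma^*$. A $\mathsf{C}\text{ - }\mathsf{RASP}$ program over $\Sigma$ is a finite sequence of operations, each defining either a Boolean-valued sequence $P(i)$ or integer-valued sequence $C(i)$ over positions $i\in[1,n]$ of the input $w=w_1\cdots w_n$, in terms of earlier operations. Boolean-valued: $P(i):=Q_a(i)$ (true iff $w_i=a$), $\lnot P_1(i)$, $P_1(i)\land P_2(i)$, $C_1(i)\le C_2(i)$, $1$ (true). Count-valued: $C(i):=\#[j\le i]\,P(j)$ (number of $j\in[1,i]$ with $P(j)$ true), $P(i)\,?\,C_1(i):C_2(i)$ ($C_1(i)$ if $P(i)$ else $C_2(i)$), $C_1(i)+C_2(i)$, $C_1(i)-C_2(i)$, $\min(C_1(i),C_2(i))$, $\max(C_1(i),C_2(i))$, $1$. A $\mathsf{C}\text{ - }\mathsf{RASP}$ language model is a $\mathsf{C}\text{ - }\mathsf{RASP}$ program with designated Boolean-valued operations $N_a$ for each $a\in\Sigma$ and $N_{\mathrm{EOS}}$. It assigns nonzero probability to a nonempty string $w=w_1\cdots w_n$ iff $N_{w_{i+1}}(i)$ is true (evaluated on input $w$) for all $1\le i\le n-1$ and $N_{\mathrm{EOS}}(n)$ is true.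 It recognizes $L$ iff it assigns nonzero probability to exactly the strings in $L$. -}

module Defs where

open import Data.Bool using (Bool; true; false; not; _∧_; if_then_else_)
open import Data.Nat using (ℕ; zero; suc)
open import Data.Integer as ℤ using (ℤ; +_)
open import Data.Fin as Fin using (Fin; zero; suc; toℕ)
open import Relation.Nullary.Decidable using (⌊_⌋)
open import Data.List as List using (List; []; _∷_)
open import Data.List.NonEmpty using (List⁺; toList)
open import Data.List.Relation.Binary.Sublist.Propositional using (_⊆_)
open import Data.Product using (Σ; _×_)
open import Data.Sum using (_⊎_)
open import Relation.Nullary using (¬_)
open import Relation.Binary.PropositionalEquality using (_≡_)
open import Function.Bundles using (_⇔_)

Language : ℕ → Set₁
Language k = List⁺ (Fin k) → Set

data PTExpr (k : ℕ) : Set where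
  sub  : List (Fin k) → PTExpr k
  neg  : PTExpr k → PTExpr k
  conj : PTExpr k → PTExpr k → PTExpr k
  disj : PTExpr k → PTExpr k → PTExpr k

-- Semantics (complement taken relative to nonempty strings).
⟦_⟧PT : ∀ {k} → PTExpr k → Language k
⟦ sub s ⟧PT w    = s ⊆ toList w        -- (not necessarily contiguous) subsequence
⟦ neg e ⟧PT w    = ¬ (⟦ e ⟧PT w)
⟦ conj e f ⟧PT w = ⟦ e ⟧PT w × ⟦ f ⟧PT w
⟦ disj e f ⟧PT w = ⟦ e ⟧PT w ⊎ ⟦ f ⟧PT w

PiecewiseTestable : ∀ {k} → Language k → Set
PiecewiseTestable {k} L = Σ (PTExpr k) λ e → ∀ w → L w ⇔ ⟦ e ⟧PT w

data Ty : Set where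
  bool count : Ty

-- Context of earlier operations (most recent first).
Ctx : Set
Ctx = List Ty

data Var : Ctx → Ty → Set where
  here  : ∀ {Γ τ} → Var (τ ∷ Γ) τ
  there : ∀ {Γ τ σ} → Var Γ τ → Var (σ ∷ Γ) τ

data Op (k : ℕ) (Γ : Ctx) : Ty → Set where
  letter : Fin k → Op k Γ bool
  notOp  : Var Γ bool → Op k Γ bool
  andOp  : Var Γ bool → Var Γ bool → Op k Γ bool
  leqOp  : Var Γ count → Var Γ count → Op k Γ bool
  trueOp : Op k Γ bool
  countOp : Var Γ bool → Op k Γ count
  iteOp   : Var Γ bool → Var Γ count → Var Γ count → Op k Γ count
  addOp   : Var Γ count → Var Γ count → Op k Γ count
  subOp   : Var Γ count → Var Γ count → Op k Γ count
  minOp   : Var Γ count → Var Γ count → Op k Γ count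
  maxOp   : Var Γ count → Var Γ count → Op k Γ count
  oneOp   : Op k Γ count

data Program (k : ℕ) : Ctx → Set where
  []  : Program k []
  _▷_ : ∀ {Γ τ} → Program k Γ → Op k Γ τ → Program k (τ ∷ Γ)

Val : Ty → Set
Val bool  = Bool
Val count = ℤ

b2n : Bool → ℕ
b2n true  = 1
b2n false = 0

prefixCount : ∀ {n} → (Fin n → Bool) → Fin n → ℕ
prefixCount f zero    = b2n (f zero)
prefixCount f (suc i) = b2n (f zero) Data.Nat.+ prefixCount (λ j → f (suc j)) i

len : ∀ {k} → List⁺ (Fin k) → ℕ
len w = List.length (toList w)

letterAt : ∀ {k} (w : List⁺ (Fin k)) → Fin (len w) → Fin k
letterAt w i = List.lookup (toList w) i

-- Positions 1..n are represented by Fin n (position i+1 ↦ i).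
evalOp : ∀ {k Γ τ} (w : List⁺ (Fin k)) →
         (∀ {σ} → Var Γ σ → Fin (len w) → Val σ) →
         Op k Γ τ → Fin (len w) → Val τ
evalOp w ρ (letter a)    i = ⌊ Fin._≟_ (letterAt w i) a ⌋
evalOp w ρ (notOp p)     i = not (ρ p i)
evalOp w ρ (andOp p q)   i = ρ p i ∧ ρ q i
evalOp w ρ (leqOp c d)   i = ⌊ ρ c i ℤ.≤? ρ d i ⌋
evalOp w ρ trueOp        i = true
evalOp w ρ (countOp p)   i = + prefixCount (ρ p) i
evalOp w ρ (iteOp p c d) i = if ρ p i then ρ c i else ρ d i
evalOp w ρ (addOp c d)   i = ρ c i ℤ.+ ρ d i
evalOp w ρ (subOp c d)   i = ρ c i ℤ.- ρ d i
evalOp w ρ (minOp c d)   i = ρ c i ℤ.⊓ ρ d i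
evalOp w ρ (maxOp c d)   i = ρ c i ℤ.⊔ ρ d i
evalOp w ρ oneOp         i = + 1

eval : ∀ {k Γ} → Program k Γ → (w : List⁺ (Fin k)) →
       ∀ {τ} → Var Γ τ → Fin (len w) → Val τ
eval (p ▷ o) w here      = evalOp w (eval p w) o
eval (p ▷ o) w (there x) = eval p w x

record LanguageModel (k : ℕ) : Set where
  field
    Γ    : Ctx
    prog : Program k Γ
    N    : Fin k → Var Γ bool
    NEOS : Var Γ bool

-- Nonzero probability on the nonempty string w.
AssignsNonzero : ∀ {k} → LanguageModel k → List⁺ (Fin k) → Set
AssignsNonzero M w =
  (∀ (i j : Fin (len w)) → toℕ j ≡ suc (toℕ i) →
     eval prog w (N (letterAt w j)) i ≡ true)          -- N_{w_{i+1}}(i), 1 ≤ i ≤ n-1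
  × (∀ (i : Fin (len w)) → suc (toℕ i) ≡ len w →
     eval prog w NEOS i ≡ true)
  where open LanguageModel M

Recognizes : ∀ {k} → LanguageModel k → Language k → Set
Recognizes M L = ∀ w → AssignsNonzero M w ⇔ L w

-- A C-RASP language model may allow every next letter and decide membership through N_EOS
-- alone, so it suffices to decide, at every position i, whether the prefix w₁…wᵢ lies in L.
-- Boolean combinations are immediate, and for a subsequence test t·a the prefix contains t·a
-- iff some position l ≤ i carries a while t already occurs strictly before l. Conditions of the
-- form "P held at some position ≤ i" (resp. "< i") are counting conditions, #[j ≤ i] P(j) ≥ 1
-- (resp. ≥ 1 + [P(i)]), so induction on the subsequence produces the required C-RASP operations.

module Submission where

open import Defs
open import Data.Nat using (ℕ)
open import Data.Product using (Σ)

open import Data.Bool using (Bool; true; false; not; _∧_; _∨_; T; if_then_else_)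
open import Data.Bool.Properties using (T-≡; T-∧; T-∨; not-involutive)
open import Data.Fin as Fin using (Fin; zero; suc; toℕ; fromℕ)
open import Data.Fin.Properties using (toℕ-fromℕ)
open import Data.Integer as ℤ using (+_)
open import Data.Integer.Properties using (drop‿+≤+)
open import Data.List using (List; []; _∷_; _++_; [_]; take; lookup; length)
open import Data.List.NonEmpty using (List⁺; _∷_; toList)
open import Data.List.Properties using (take-all)
open import Data.List.Relation.Binary.Sublist.Propositional using (_⊆_; []; _∷_; _∷ʳ_; minimum)
open import Data.List.Reverse using (Reverse; []; _∶_∶ʳ_; reverseView)
open import Data.Nat as ℕ using (zero; suc; z≤n; s≤s)
open import Data.Nat.Properties using (≤-refl; ≤-trans; ≤-reflexive; m≤m+n; m≤n+m; +-mono-≤; n≮n; suc-injective)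
open import Data.Product using (_×_; _,_; ∃-syntax)
open import Data.Product.Function.NonDependent.Propositional using (_×-⇔_)
open import Data.Sum.Function.Propositional using (_⊎-⇔_)
open import Data.Unit using (tt)
open import Function using (_∘_)
open import Function.Bundles using (_⇔_; mk⇔; Equivalence)
open import Function.Properties.Equivalence using () renaming (trans to infixr 4 _⟨⇔⟩_)
open import Function.Construct.Symmetry using (⇔-sym)
open import Function.Related.Propositional using (module EquationalReasoning)
open import Function.Related.TypeIsomorphisms using (¬-cong-⇔)
open import Relation.Binary.PropositionalEquality using (_≡_; refl; sym; trans; cong; cong₂; subst)
open import Relation.Nullary using (¬_; contradiction)
open import Relation.Nullary.Decidable using (Dec; ⌊_⌋; toWitness; fromWitness)

open Equivalence using (to; from)

T-not : ∀ {b} → T (not b) ⇔ (¬ T b)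
T-not {true}  = mk⇔ (λ ()) (λ ¬⊤ → ¬⊤ tt)
T-not {false} = mk⇔ (λ _ ()) (λ _ → tt)

T-⌊⌋ : ∀ {P : Set} {P? : Dec P} → T ⌊ P? ⌋ ⇔ P
T-⌊⌋ = mk⇔ toWitness fromWitness

T-+≤? : ∀ {m n} → T ⌊ + m ℤ.≤? + n ⌋ ⇔ m ℕ.≤ n
T-+≤? = T-⌊⌋ ⟨⇔⟩ mk⇔ drop‿+≤+ ℤ.+≤+

not-∧-not : ∀ a b → not (not a ∧ not b) ≡ a ∨ b
not-∧-not true  b = refl
not-∧-not false b = not-involutive b

T⇒1≤b2n : ∀ {b} → T b → 1 ℕ.≤ b2n b
T⇒1≤b2n {true} _ = s≤s z≤n

SomeBelow : ∀ {n} → ℕ → (Fin n → Set) → Set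
SomeBelow m P = ∃[ l ] (toℕ l ℕ.< m × P l)

SomeBelow-suc : ∀ {n m} {P : Fin (suc n) → Set} → SomeBelow m (P ∘ suc) → SomeBelow (suc m) P
SomeBelow-suc (l , l<m , Pl) = suc l , s≤s l<m , Pl

SomeBelow-cong : ∀ {n m} {P Q : Fin n → Set} → (∀ l → P l ⇔ Q l) → SomeBelow m P ⇔ SomeBelow m Q
SomeBelow-cong P⇔Q = mk⇔ (λ (l , l<m , Pl) → l , l<m , to (P⇔Q l) Pl)
                         (λ (l , l<m , Ql) → l , l<m , from (P⇔Q l) Ql)

b2n≤prefixCount : ∀ {n} (f : Fin n → Bool) i → b2n (f i) ℕ.≤ prefixCount f i
b2n≤prefixCount f zero    = ≤-refl
b2n≤prefixCount f (suc i) = ≤-trans (b2n≤prefixCount (f ∘ suc) i) (m≤n+m _ (b2n (f zero)))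

prefixCount-cong : ∀ {n} {f g : Fin n → Bool} → (∀ j → f j ≡ g j) → ∀ i → prefixCount f i ≡ prefixCount g i
prefixCount-cong f≗g zero    = cong b2n (f≗g zero)
prefixCount-cong f≗g (suc i) = cong₂ ℕ._+_ (cong b2n (f≗g zero)) (prefixCount-cong (f≗g ∘ suc) i)

prefixCount-positive⇒ : ∀ {n} (f : Fin n → Bool) i → 1 ℕ.≤ prefixCount f i → SomeBelow (suc (toℕ i)) (T ∘ f)
prefixCount-positive⇒ f zero p with f zero in eq
... | true = zero , s≤s z≤n , from T-≡ eq
prefixCount-positive⇒ f (suc i) p with f zero in eq
... | true  = zero , s≤s z≤n , from T-≡ eq
... | false = SomeBelow-suc (prefixCount-positive⇒ (f ∘ suc) i p)

prefixCount-positive⇐ : ∀ {n} (f : Fin n → Bool) i → SomeBelow (suc (toℕ i)) (T ∘ f) → 1 ℕ.≤ prefixCount f i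
prefixCount-positive⇐ f zero    (zero , _ , fl)          = T⇒1≤b2n fl
prefixCount-positive⇐ f zero    (suc l , s≤s () , _)
prefixCount-positive⇐ f (suc i) (zero , _ , fl)          = ≤-trans (T⇒1≤b2n fl) (m≤m+n _ _)
prefixCount-positive⇐ f (suc i) (suc l , s≤s l≤i , fl) =
  ≤-trans (prefixCount-positive⇐ (f ∘ suc) i (l , l≤i , fl)) (m≤n+m _ _)

prefixCount-exceeds⇒ : ∀ {n} (f : Fin n → Bool) i →
                       suc (b2n (f i)) ℕ.≤ prefixCount f i → SomeBelow (toℕ i) (T ∘ f)
prefixCount-exceeds⇒ f zero p = contradiction p (n≮n _)
prefixCount-exceeds⇒ f (suc i) p with f zero in eq
... | true  = zero , s≤s z≤n , from T-≡ eq
... | false = SomeBelow-suc (prefixCount-exceeds⇒ (f ∘ suc) i p)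

prefixCount-exceeds⇐ : ∀ {n} (f : Fin n → Bool) i →
                       SomeBelow (toℕ i) (T ∘ f) → suc (b2n (f i)) ℕ.≤ prefixCount f i
prefixCount-exceeds⇐ f (suc i) (zero , _ , fl)          = +-mono-≤ (T⇒1≤b2n fl) (b2n≤prefixCount (f ∘ suc) i)
prefixCount-exceeds⇐ f (suc i) (suc l , s≤s l<i , fl) =
  ≤-trans (prefixCount-exceeds⇐ (f ∘ suc) i (l , l<i , fl)) (m≤n+m _ _)

module _ {A : Set} where

  Occurrence : (xs : List A) → List A → A → Fin (length xs) → Set
  Occurrence xs t a l = lookup xs l ≡ a × t ⊆ take (toℕ l) xs

  ++[]⊈[] : ∀ {t : List A} {a} → ¬ (t ++ [ a ] ⊆ [])
  ++[]⊈[] {[]}    ()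
  ++[]⊈[] {_ ∷ _} ()

  Occurrence-∷ʳ : ∀ {xs m t a} x → SomeBelow m (Occurrence xs t a) → SomeBelow (suc m) (Occurrence (x ∷ xs) t a)
  Occurrence-∷ʳ x (l , l<m , xs[l]≡a , t⊆) = suc l , s≤s l<m , xs[l]≡a , x ∷ʳ t⊆

  ++[]⊆take⇒ : ∀ xs m t a → t ++ [ a ] ⊆ take m xs → SomeBelow m (Occurrence xs t a)
  ++[]⊆take⇒ xs       zero    t a p = contradiction p ++[]⊈[]
  ++[]⊆take⇒ []       (suc m) t a p = contradiction p ++[]⊈[]
  ++[]⊆take⇒ (x ∷ xs) (suc m) []      a (.x ∷ʳ p) = Occurrence-∷ʳ x (++[]⊆take⇒ xs m [] a p)
  ++[]⊆take⇒ (x ∷ xs) (suc m) (y ∷ t) a (.x ∷ʳ p) = Occurrence-∷ʳ x (++[]⊆take⇒ xs m (y ∷ t) a p)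
  ++[]⊆take⇒ (x ∷ xs) (suc m) []      a (a≡x ∷ _) = zero , s≤s z≤n , sym a≡x , []
  ++[]⊆take⇒ (x ∷ xs) (suc m) (y ∷ t) a (y≡x ∷ p) with ++[]⊆take⇒ xs m t a p
  ... | l , l<m , xs[l]≡a , t⊆ = suc l , s≤s l<m , xs[l]≡a , y≡x ∷ t⊆

  ++[]⊆take⇐ : ∀ xs m t a → SomeBelow m (Occurrence xs t a) → t ++ [ a ] ⊆ take m xs
  ++[]⊆take⇐ (x ∷ xs) (suc m) [] a (zero , _ , refl , []) = refl ∷ minimum _
  ++[]⊆take⇐ (x ∷ xs) (suc m) t a (suc l , s≤s l<m , xs[l]≡a , .x ∷ʳ t⊆) =
    x ∷ʳ ++[]⊆take⇐ xs m t a (l , l<m , xs[l]≡a , t⊆)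
  ++[]⊆take⇐ (x ∷ xs) (suc m) (y ∷ t) a (suc l , s≤s l<m , xs[l]≡a , y≡x ∷ t⊆) =
    y≡x ∷ ++[]⊆take⇐ xs m t a (l , l<m , xs[l]≡a , t⊆)

  ++[]⊆take : ∀ xs m t a → (t ++ [ a ] ⊆ take m xs) ⇔ SomeBelow m (Occurrence xs t a)
  ++[]⊆take xs m t a = mk⇔ (++[]⊆take⇒ xs m t a) (++[]⊆take⇐ xs m t a)

-- C-RASP operations as expression trees; compiling a tree flattens it into a program.

infixr 6 _∧ₑ_
infix  4 _≤ₑ_
infixl 6 _+ₑ_ _-ₑ_

data Expr (k : ℕ) : Ty → Set where
  letter          : Fin k → Expr k bool
  ¬ₑ_             : Expr k bool → Expr k bool
  _∧ₑ_            : Expr k bool → Expr k bool → Expr k bool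
  _≤ₑ_            : Expr k count → Expr k count → Expr k bool
  trueₑ           : Expr k bool
  #ₑ_             : Expr k bool → Expr k count
  ifₑ_then_else_  : Expr k bool → Expr k count → Expr k count → Expr k count
  _+ₑ_ _-ₑ_ _⊓ₑ_ _⊔ₑ_ : Expr k count → Expr k count → Expr k count
  1ₑ              : Expr k count

⟦_⟧ₑ : ∀ {k τ} → Expr k τ → (w : List⁺ (Fin k)) → Fin (len w) → Val τ
⟦ letter a ⟧ₑ             w i = ⌊ letterAt w i Fin.≟ a ⌋
⟦ ¬ₑ e ⟧ₑ                 w i = not (⟦ e ⟧ₑ w i)
⟦ e ∧ₑ f ⟧ₑ               w i = ⟦ e ⟧ₑ w i ∧ ⟦ f ⟧ₑ w i
⟦ c ≤ₑ d ⟧ₑ               w i = ⌊ ⟦ c ⟧ₑ w i ℤ.≤? ⟦ d ⟧ₑ w i ⌋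
⟦ trueₑ ⟧ₑ                w i = true
⟦ #ₑ e ⟧ₑ                 w i = + prefixCount (⟦ e ⟧ₑ w) i
⟦ ifₑ e then c else d ⟧ₑ w i = if ⟦ e ⟧ₑ w i then ⟦ c ⟧ₑ w i else ⟦ d ⟧ₑ w i
⟦ c +ₑ d ⟧ₑ               w i = ⟦ c ⟧ₑ w i ℤ.+ ⟦ d ⟧ₑ w i
⟦ c -ₑ d ⟧ₑ               w i = ⟦ c ⟧ₑ w i ℤ.- ⟦ d ⟧ₑ w i
⟦ c ⊓ₑ d ⟧ₑ               w i = ⟦ c ⟧ₑ w i ℤ.⊓ ⟦ d ⟧ₑ w i
⟦ c ⊔ₑ d ⟧ₑ               w i = ⟦ c ⟧ₑ w i ℤ.⊔ ⟦ d ⟧ₑ w i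
⟦ 1ₑ ⟧ₑ                   w i = + 1

data _⊑_ {k Γ} (p : Program k Γ) : ∀ {Δ} → Program k Δ → Set where
  ⊑-refl : p ⊑ p
  ⊑-step : ∀ {Δ τ} {q : Program k Δ} → p ⊑ q → (o : Op k Δ τ) → p ⊑ (q ▷ o)

module _ {k : ℕ} where

  ⊑-trans : ∀ {Γ Δ Θ} {p : Program k Γ} {q : Program k Δ} {r : Program k Θ} → p ⊑ q → q ⊑ r → p ⊑ r
  ⊑-trans p⊑q ⊑-refl          = p⊑q
  ⊑-trans p⊑q (⊑-step q⊑r o) = ⊑-step (⊑-trans p⊑q q⊑r) o

  weaken : ∀ {Γ Δ τ} {p : Program k Γ} {q : Program k Δ} → p ⊑ q → Var Γ τ → Var Δ τ
  weaken ⊑-refl          x = x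
  weaken (⊑-step p⊑q o) x = there (weaken p⊑q x)

  Computes : ∀ {Γ τ} → Program k Γ → Var Γ τ → Expr k τ → Set
  Computes p x e = ∀ w i → eval p w x i ≡ ⟦ e ⟧ₑ w i

  Computes-weaken : ∀ {Γ Δ τ} {p : Program k Γ} {q : Program k Δ} {x : Var Γ τ} {e : Expr k τ} →
                    (p⊑q : p ⊑ q) → Computes p x e → Computes q (weaken p⊑q x) e
  Computes-weaken         ⊑-refl          = λ px=e → px=e
  Computes-weaken {e = e} (⊑-step p⊑q o) = Computes-weaken {e = e} p⊑q

  record Compiled {Γ τ} (p : Program k Γ) (e : Expr k τ) : Set where
    field
      {Δ}      : Ctx
      prog     : Program k Δ
      extends  : p ⊑ prog
      var      : Var Δ τ
      computes : Computes prog var e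

  record Compiled₂ {Γ σ τ} (p : Program k Γ) (e₁ : Expr k σ) (e₂ : Expr k τ) : Set where
    field
      {Δ}       : Ctx
      prog      : Program k Δ
      extends   : p ⊑ prog
      var₁      : Var Δ σ
      var₂      : Var Δ τ
      computes₁ : Computes prog var₁ e₁
      computes₂ : Computes prog var₂ e₂

  emit : ∀ {Γ Δ τ} {p : Program k Γ} {q : Program k Δ} {e : Expr k τ} →
         p ⊑ q → (o : Op k Δ τ) → (∀ w i → evalOp w (eval q w) o i ≡ ⟦ e ⟧ₑ w i) → Compiled p e
  emit p⊑q o o=e = record { prog = _ ▷ o ; extends = ⊑-step p⊑q o ; var = here ; computes = o=e }

  compile  : ∀ {Γ τ} (e : Expr k τ) (p : Program k Γ) → Compiled p e
  compile₂ : ∀ {Γ σ τ} (e₁ : Expr k σ) (e₂ : Expr k τ) (p : Program k Γ) → Compiled₂ p e₁ e₂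

  compile (letter a) p = emit ⊑-refl (letter a) (λ _ _ → refl)
  compile trueₑ      p = emit ⊑-refl trueOp (λ _ _ → refl)
  compile 1ₑ         p = emit ⊑-refl oneOp (λ _ _ → refl)
  compile (¬ₑ e)     p = emit extends (notOp var) (λ w i → cong not (computes w i))
    where open Compiled (compile e p)
  compile (#ₑ e)     p = emit extends (countOp var) (λ w i → cong +_ (prefixCount-cong (computes w) i))
    where open Compiled (compile e p)
  compile (e₁ ∧ₑ e₂) p = emit extends (andOp var₁ var₂) (λ w i → cong₂ _∧_ (computes₁ w i) (computes₂ w i))
    where open Compiled₂ (compile₂ e₁ e₂ p)
  compile (c₁ ≤ₑ c₂) p =
    emit extends (leqOp var₁ var₂) (λ w i → cong₂ (λ x y → ⌊ x ℤ.≤? y ⌋) (computes₁ w i) (computes₂ w i))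
    where open Compiled₂ (compile₂ c₁ c₂ p)
  compile (c₁ +ₑ c₂) p = emit extends (addOp var₁ var₂) (λ w i → cong₂ ℤ._+_ (computes₁ w i) (computes₂ w i))
    where open Compiled₂ (compile₂ c₁ c₂ p)
  compile (c₁ -ₑ c₂) p = emit extends (subOp var₁ var₂) (λ w i → cong₂ ℤ._-_ (computes₁ w i) (computes₂ w i))
    where open Compiled₂ (compile₂ c₁ c₂ p)
  compile (c₁ ⊓ₑ c₂) p = emit extends (minOp var₁ var₂) (λ w i → cong₂ ℤ._⊓_ (computes₁ w i) (computes₂ w i))
    where open Compiled₂ (compile₂ c₁ c₂ p)
  compile (c₁ ⊔ₑ c₂) p = emit extends (maxOp var₁ var₂) (λ w i → cong₂ ℤ._⊔_ (computes₁ w i) (computes₂ w i))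
    where open Compiled₂ (compile₂ c₁ c₂ p)
  compile (ifₑ e then c₁ else c₂) p =
    emit (⊑-trans (Compiled.extends ce) extends) (iteOp (weaken extends (Compiled.var ce)) var₁ var₂)
      (λ w i → trans (cong (λ b → if b then eval prog w var₁ i else eval prog w var₂ i)
                           (Computes-weaken {e = e} extends (Compiled.computes ce) w i))
                     (cong₂ (λ c d → if ⟦ e ⟧ₑ w i then c else d) (computes₁ w i) (computes₂ w i)))
    where ce = compile e p
          open Compiled₂ (compile₂ c₁ c₂ (Compiled.prog ce))

  compile₂ e₁ e₂ p = record
    { prog      = prog c₂
    ; extends   = ⊑-trans (extends c₁) (extends c₂)
    ; var₁      = weaken (extends c₂) (var c₁)
    ; var₂      = var c₂
    ; computes₁ = Computes-weaken {e = e₁} (extends c₂) (computes c₁)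
    ; computes₂ = computes c₂
    }
    where open Compiled
          c₁ = compile e₁ p
          c₂ = compile e₂ (prog c₁)

module _ {k : ℕ} where

  _∨ₑ_ : Expr k bool → Expr k bool → Expr k bool
  e ∨ₑ f = ¬ₑ (¬ₑ e ∧ₑ ¬ₑ f)

  someUpTo : Expr k bool → Expr k bool
  someUpTo e = 1ₑ ≤ₑ #ₑ e

  -- #[j ≤ i] e(j) exceeds the contribution [e(i)] of position i itself iff e held before i.
  someBefore : Expr k bool → Expr k bool
  someBefore e = (ifₑ e then 1ₑ +ₑ 1ₑ else 1ₑ) ≤ₑ #ₑ e

  someUpTo-correct : ∀ e w i → T (⟦ someUpTo e ⟧ₑ w i) ⇔ SomeBelow (suc (toℕ i)) (T ∘ ⟦ e ⟧ₑ w)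
  someUpTo-correct e w i =
    T-+≤? ⟨⇔⟩ mk⇔ (prefixCount-positive⇒ (⟦ e ⟧ₑ w) i) (prefixCount-positive⇐ (⟦ e ⟧ₑ w) i)

  someBefore-correct : ∀ e w i → T (⟦ someBefore e ⟧ₑ w i) ⇔ SomeBelow (toℕ i) (T ∘ ⟦ e ⟧ₑ w)
  someBefore-correct e w i = begin
    T (⟦ someBefore e ⟧ₑ w i)
      ≡⟨ cong (λ c → T ⌊ c ℤ.≤? + prefixCount (⟦ e ⟧ₑ w) i ⌋) (if-2-1 (⟦ e ⟧ₑ w i)) ⟩
    T ⌊ + suc (b2n (⟦ e ⟧ₑ w i)) ℤ.≤? + prefixCount (⟦ e ⟧ₑ w) i ⌋
      ∼⟨ T-+≤? ⟩
    suc (b2n (⟦ e ⟧ₑ w i)) ℕ.≤ prefixCount (⟦ e ⟧ₑ w) i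
      ∼⟨ mk⇔ (prefixCount-exceeds⇒ (⟦ e ⟧ₑ w) i) (prefixCount-exceeds⇐ (⟦ e ⟧ₑ w) i) ⟩
    SomeBelow (toℕ i) (T ∘ ⟦ e ⟧ₑ w) ∎
    where
    open EquationalReasoning
    if-2-1 : ∀ b → (if b then + 1 ℤ.+ + 1 else + 1) ≡ + suc (b2n b)
    if-2-1 true  = refl
    if-2-1 false = refl

  subseqBefore : ∀ {s : List (Fin k)} → Reverse s → Expr k bool
  occurrence   : ∀ {t : List (Fin k)} → Reverse t → Fin k → Expr k bool

  subseqBefore []           = trueₑ
  subseqBefore (t ∶ r ∶ʳ a) = someBefore (occurrence r a)

  occurrence r a = letter a ∧ₑ subseqBefore r

  subseqUpTo : ∀ {s : List (Fin k)} → Reverse s → Expr k bool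
  subseqUpTo []           = trueₑ
  subseqUpTo (t ∶ r ∶ʳ a) = someUpTo (occurrence r a)

  subseqBefore-correct : ∀ {s} (r : Reverse s) w i →
                         T (⟦ subseqBefore r ⟧ₑ w i) ⇔ s ⊆ take (toℕ i) (toList w)
  occurrence-correct : ∀ {t} (r : Reverse t) a w l →
                       T (⟦ occurrence r a ⟧ₑ w l) ⇔ Occurrence (toList w) t a l

  subseqBefore-correct []           w i = mk⇔ (λ _ → minimum _) (λ _ → tt)
  subseqBefore-correct (t ∶ r ∶ʳ a) w i =
    someBefore-correct (occurrence r a) w i ⟨⇔⟩
    SomeBelow-cong (occurrence-correct r a w) ⟨⇔⟩
    ⇔-sym (++[]⊆take (toList w) (toℕ i) t a)

  occurrence-correct r a w l = T-∧ ⟨⇔⟩ (T-⌊⌋ ×-⇔ subseqBefore-correct r w l)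

  subseqUpTo-correct : ∀ {s} (r : Reverse s) w i →
                       T (⟦ subseqUpTo r ⟧ₑ w i) ⇔ s ⊆ take (suc (toℕ i)) (toList w)
  subseqUpTo-correct []           w i = mk⇔ (λ _ → minimum _) (λ _ → tt)
  subseqUpTo-correct (t ∶ r ∶ʳ a) w i =
    someUpTo-correct (occurrence r a) w i ⟨⇔⟩
    SomeBelow-cong (occurrence-correct r a w) ⟨⇔⟩
    ⇔-sym (++[]⊆take (toList w) (suc (toℕ i)) t a)

prefix : ∀ {k} (w : List⁺ (Fin k)) → Fin (len w) → List⁺ (Fin k)
prefix (x ∷ xs) i = x ∷ take (toℕ i) xs

prefix-full : ∀ {k} (w : List⁺ (Fin k)) i → suc (toℕ i) ≡ len w → prefix w i ≡ w
prefix-full (x ∷ xs) i 1+i≡n = cong (x ∷_) (take-all (toℕ i) xs (≤-reflexive (sym (suc-injective 1+i≡n))))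

lastPosition : ∀ {k} (w : List⁺ (Fin k)) → Σ (Fin (len w)) λ i → suc (toℕ i) ≡ len w
lastPosition (x ∷ xs) = fromℕ (length xs) , cong suc (toℕ-fromℕ (length xs))

prefixTest : ∀ {k} → PTExpr k → Expr k bool
prefixTest (sub s)    = subseqUpTo (reverseView s)
prefixTest (neg e)    = ¬ₑ prefixTest e
prefixTest (conj e f) = prefixTest e ∧ₑ prefixTest f
prefixTest (disj e f) = prefixTest e ∨ₑ prefixTest f

prefixTest-correct : ∀ {k} (e : PTExpr k) w i → T (⟦ prefixTest e ⟧ₑ w i) ⇔ ⟦ e ⟧PT (prefix w i)
prefixTest-correct (sub s) (x ∷ xs) i = subseqUpTo-correct (reverseView s) (x ∷ xs) i
prefixTest-correct (neg e)    w i = T-not ⟨⇔⟩ ¬-cong-⇔ (prefixTest-correct e w i)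
prefixTest-correct (conj e f) w i = T-∧ ⟨⇔⟩ (prefixTest-correct e w i ×-⇔ prefixTest-correct f w i)
prefixTest-correct (disj e f) w i rewrite not-∧-not (⟦ prefixTest e ⟧ₑ w i) (⟦ prefixTest f ⟧ₑ w i) =
  T-∨ ⟨⇔⟩ (prefixTest-correct e w i ⊎-⇔ prefixTest-correct f w i)

recognizer-from-prefixTest : ∀ {k} (L : Language k) (b : Expr k bool) →
  (∀ w i → T (⟦ b ⟧ₑ w i) ⇔ L (prefix w i)) → Σ (LanguageModel k) λ M → Recognizes M L
recognizer-from-prefixTest {k} L b b⇔L = M , λ w → mk⇔ (accepted⇒L w) (L⇒accepted w)
  where
  -- Every N_a is the constant true, so only N_EOS at the last position constrains w.
  open Compiled (compile b [])
  M : LanguageModel k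
  M = record { Γ = bool ∷ Δ ; prog = prog ▷ trueOp ; N = λ _ → here ; NEOS = there var }

  eos⇔L : ∀ w i → eval prog w var i ≡ true ⇔ L (prefix w i)
  eos⇔L w i rewrite computes w i = ⇔-sym T-≡ ⟨⇔⟩ b⇔L w i

  accepted⇒L : ∀ w → AssignsNonzero M w → L w
  accepted⇒L w (_ , eos) =
    let n , n-last = lastPosition w in subst L (prefix-full w n n-last) (to (eos⇔L w n) (eos n n-last))

  L⇒accepted : ∀ w → L w → AssignsNonzero M w
  L⇒accepted w Lw =
    (λ _ _ _ → refl) , λ i i-last → from (eos⇔L w i) (subst L (sym (prefix-full w i i-last)) Lw)

corollary1 : (k : ℕ) (L : Language k) → PiecewiseTestable L →
             Σ (LanguageModel k) λ M → Recognizes M L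
corollary1 k L (e , L⇔e) =
  recognizer-from-prefixTest L (prefixTest e) λ w i → prefixTest-correct e w i ⟨⇔⟩ ⇔-sym (L⇔e (prefix w i))
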